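{- Let $\mathcal{O}$ be a CM order, $I=(v)=v\mathcal{O}$ an integral invertible ideal of $\mathcal{O}$, and $x\in I\setminus\{0\}$ minimizing $\mathrm{tr}(x\overline{x})$ over $I\setminus\{0\}$. Then there exists $y\neq0$ in $v\mathcal{O}^+$ or in $v\mathcal{O}^-$ such that $0<\mathrm{tr}(y\overline{y})\leq2\,\mathrm{tr}(x\overline{x})$. Furthermore, $v\mathcal{O}^+\subseteq I$ and $v\mathcal{O}^-\subseteq I$.
   Context: An order is a commutative unitary ring whose additive group is isomorphic to $\mathbb{Z}^n$. A CM order is an order $\mathcal{O}$ with an involutive ring automorphism $x\mapsto\overline{x}$ such that $x\mapsto\mathrm{tr}(x\overline{x})$ is positive definite ($\mathrm{tr}$ the trace of the multiplication map). $\mathcal{O}^+=\{x\in\mathcal{O}:x=\overline{x}\}$, $\mathcal{O}^-=\{x\in\mathcal{O}:x=-\overline{x}\}$. -}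

module Defs where

open import Data.Nat using (ℕ; zero; suc)
open import Data.Integer using (ℤ; _+_; _*_; -_; _<_; _≤_; 0ℤ; 1ℤ)
open import Data.Fin using (Fin; zero; suc)
open import Data.Vec using (Vec; lookup; replicate; zipWith; map; _[_]≔_)
open import Data.Product using (Σ; ∃; _×_)
open import Relation.Binary.PropositionalEquality using (_≡_; _≢_)

-- An order of rank n is modelled concretely: its additive group is Z^n
-- (elements = integer coordinate vectors w.r.t. a fixed Z-basis e_0..e_{n-1}),
-- multiplication is the Z-bilinear map given by structure constants
-- e_i * e_j = str i j, and the involution is the Z-linear map with e_i ↦ conjB i.

Σℤ : ∀ {n} → (Fin n → ℤ) → ℤ
Σℤ {zero}  f = 0ℤ
Σℤ {suc n} f = f zero + Σℤ (λ i → f (suc i))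

Elt : ℕ → Set
Elt n = Vec ℤ n

zeroV : ∀ {n} → Elt n
zeroV {n} = replicate n 0ℤ

_⊕_ : ∀ {n} → Elt n → Elt n → Elt n
_⊕_ = zipWith _+_

_⋆_ : ∀ {n} → ℤ → Elt n → Elt n
k ⋆ v = map (k *_) v

ΣV : ∀ {m n} → (Fin m → Elt n) → Elt n
ΣV {zero}  f = zeroV
ΣV {suc m} f = f zero ⊕ ΣV (λ i → f (suc i))

basis : ∀ {n} → Fin n → Elt n
basis j = zeroV [ j ]≔ 1ℤ

mulW : ∀ {n} → (Fin n → Fin n → Elt n) → Elt n → Elt n → Elt n
mulW str x y = ΣV (λ i → ΣV (λ j → (lookup x i * lookup y j) ⋆ str i j))

linW : ∀ {n} → (Fin n → Elt n) → Elt n → Elt n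
linW f x = ΣV (λ i → lookup x i ⋆ f i)

-- trace of the multiplication-by-x map (a Z-linear endomorphism of Z^n)
trW : ∀ {n} → (Fin n → Fin n → Elt n) → Elt n → ℤ
trW str x = Σℤ (λ j → lookup (mulW str x (basis j)) j)

record CMOrder (n : ℕ) : Set where
  field
    str   : Fin n → Fin n → Elt n
    one   : Elt n
    conjB : Fin n → Elt n
    -- commutative unitary ring axioms (additive structure and
    -- distributivity are automatic from bilinearity)
    mul-comm  : ∀ x y → mulW str x y ≡ mulW str y x
    mul-assoc : ∀ x y z → mulW str (mulW str x y) z ≡ mulW str x (mulW str y z)
    mul-one   : ∀ x → mulW str one x ≡ x
    -- involutive ring automorphism (additivity automatic from linearity)
    conj-mul   : ∀ x y → linW conjB (mulW str x y) ≡ mulW str (linW conjB x) (linW conjB y)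
    conj-one   : linW conjB one ≡ one
    conj-invol : ∀ x → linW conjB (linW conjB x) ≡ x
    posdef : ∀ x → x ≢ zeroV → 0ℤ < trW str (mulW str x (linW conjB x))

module _ {n : ℕ} (O : CMOrder n) where
  open CMOrder O

  _·_ : Elt n → Elt n → Elt n
  _·_ = mulW str

  conj : Elt n → Elt n
  conj = linW conjB

  tr : Elt n → ℤ
  tr = trW str

  q : Elt n → ℤ
  q x = tr (x · conj x)

  -- zero divisors / principal invertible ideals:
  -- v O is an invertible ideal iff v is a non-zero-divisor of O
  NonZeroDivisor : Elt n → Set
  NonZeroDivisor v = ∀ a → v · a ≡ zeroV → a ≡ zeroV

  InPrincipal : Elt n → Elt n → Set
  InPrincipal v y = Σ (Elt n) (λ a → y ≡ v · a)

  InPlus : Elt n → Elt n → Set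
  InPlus v y = Σ (Elt n) (λ a → conj a ≡ a × y ≡ v · a)

  InMinus : Elt n → Elt n → Set
  InMinus v y = Σ (Elt n) (λ a → conj a ≡ (-1ℤ) ⋆ a × y ≡ v · a)
    where -1ℤ = - 1ℤ

-- Write x = v a and split a into a + ā ∈ O⁺ and a − ā ∈ O⁻. With the
-- symmetric bilinear form B(u, w) = tr(v v̄ u w) one has q(v b) = B(b, b̄),
-- so the polarization identity gives the parallelogram law
--   q(v(a + ā)) + q(v(a − ā)) = B(a+ā, a+ā) − B(a−ā, a−ā) = 4 B(a, ā) = 4 q(x),
-- and one of the two terms is at most 2 q(x). If a + ā or a − ā vanishes, a
-- itself lies in O⁻ or O⁺ and y = x works.
module Submission where

open import Defs
open import Data.Nat using (ℕ; zero; suc)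
open import Data.Integer using (ℤ; _+_; _*_; -_; _<_; _≤_; _≤?_; 0ℤ; 1ℤ; +_)
open import Data.Integer.Properties
  using (_≟_; +-comm; +-identityʳ; *-zeroʳ; *-assoc; *-distribˡ-+; *-distribʳ-+;
         +-monoʳ-≤; +-mono-<; <⇒≤; <-irrefl; ≰⇒>; module ≤-Reasoning)
open import Data.Integer.Tactic.RingSolver using (solve-∀)
open import Data.Fin using (Fin; zero; suc)
open import Data.Vec using ([]; _∷_; lookup)
open import Data.Vec.Properties using (≡-dec; ∷-injective; lookup-zipWith; lookup-map)
open import Data.Product using (Σ; _×_; _,_)
open import Data.Sum using (_⊎_; inj₁; inj₂)
open import Data.Empty using (⊥-elim)
open import Function using (_∘_)
open import Relation.Nullary using (yes; no)
open import Relation.Binary.PropositionalEquality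
  using (_≡_; _≢_; refl; sym; trans; cong; cong₂; module ≡-Reasoning)

i≤2*i : ∀ {i} → 0ℤ ≤ i → i ≤ (+ 2) * i
i≤2*i {i} 0≤i = begin
  i              ≡⟨ sym (+-identityʳ i) ⟩
  i + 0ℤ         ≤⟨ +-monoʳ-≤ i 0≤i ⟩
  i + i          ≡⟨ double i ⟩
  (+ 2) * i      ∎
  where
  open ≤-Reasoning
  double : ∀ i → i + i ≡ (+ 2) * i
  double = solve-∀

+≡4*⇒≤2*⊎≤2* : ∀ {p r s} → p + r ≡ (+ 4) * s → p ≤ (+ 2) * s ⊎ r ≤ (+ 2) * s
+≡4*⇒≤2*⊎≤2* {p} {r} {s} p+r≡4s with p ≤? (+ 2) * s | r ≤? (+ 2) * s
... | yes p≤2s | _        = inj₁ p≤2s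
... | no _     | yes r≤2s = inj₂ r≤2s
... | no p≰2s  | no r≰2s  =
  ⊥-elim (<-irrefl (trans (sym (split s)) (sym p+r≡4s)) (+-mono-< (≰⇒> p≰2s) (≰⇒> r≰2s)))
  where
  split : ∀ s → (+ 4) * s ≡ (+ 2) * s + (+ 2) * s
  split = solve-∀

open ≡-Reasoning

⊕-comm : ∀ {n} (u w : Elt n) → u ⊕ w ≡ w ⊕ u
⊕-comm []      []      = refl
⊕-comm (a ∷ u) (b ∷ w) = cong₂ _∷_ (+-comm a b) (⊕-comm u w)

⊕-interchange : ∀ {n} (u u′ w w′ : Elt n) → (u ⊕ u′) ⊕ (w ⊕ w′) ≡ (u ⊕ w) ⊕ (u′ ⊕ w′)
⊕-interchange []      []        []      []        = refl
⊕-interchange (a ∷ u) (a′ ∷ u′) (b ∷ w) (b′ ∷ w′) =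
  cong₂ _∷_ (interchange a a′ b b′) (⊕-interchange u u′ w w′)
  where
  interchange : ∀ a a′ b b′ → (a + a′) + (b + b′) ≡ (a + b) + (a′ + b′)
  interchange = solve-∀

⊕-zeroV : ∀ {n} → zeroV {n} ⊕ zeroV ≡ zeroV
⊕-zeroV {zero}  = refl
⊕-zeroV {suc n} = cong (0ℤ ∷_) ⊕-zeroV

⋆-zeroV : ∀ {n} k → k ⋆ zeroV {n} ≡ zeroV
⋆-zeroV {zero}  k = refl
⋆-zeroV {suc n} k = cong₂ _∷_ (*-zeroʳ k) (⋆-zeroV k)

⋆-distribˡ-⊕ : ∀ {n} k (u w : Elt n) → k ⋆ (u ⊕ w) ≡ (k ⋆ u) ⊕ (k ⋆ w)
⋆-distribˡ-⊕ k []      []      = refl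
⋆-distribˡ-⊕ k (a ∷ u) (b ∷ w) = cong₂ _∷_ (*-distribˡ-+ k a b) (⋆-distribˡ-⊕ k u w)

⋆-distribʳ-+ : ∀ {n} k l (u : Elt n) → (k + l) ⋆ u ≡ (k ⋆ u) ⊕ (l ⋆ u)
⋆-distribʳ-+ k l []      = refl
⋆-distribʳ-+ k l (a ∷ u) = cong₂ _∷_ (*-distribʳ-+ a k l) (⋆-distribʳ-+ k l u)

⋆-assoc : ∀ {n} k l (u : Elt n) → (k * l) ⋆ u ≡ k ⋆ (l ⋆ u)
⋆-assoc k l []      = refl
⋆-assoc k l (a ∷ u) = cong₂ _∷_ (*-assoc k l a) (⋆-assoc k l u)

⊕≡zeroV⇒≡-⋆ : ∀ {n} (u w : Elt n) → u ⊕ w ≡ zeroV → w ≡ (- 1ℤ) ⋆ u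
⊕≡zeroV⇒≡-⋆ []      []      _ = refl
⊕≡zeroV⇒≡-⋆ (a ∷ u) (b ∷ w) e with ∷-injective e
... | a+b≡0 , rest = cong₂ _∷_ (scalar a b a+b≡0) (⊕≡zeroV⇒≡-⋆ u w rest)
  where
  negate : ∀ a b → b ≡ - 1ℤ * a + (a + b)
  negate = solve-∀
  scalar : ∀ a b → a + b ≡ 0ℤ → b ≡ - 1ℤ * a
  scalar a b h = trans (negate a b) (trans (cong (λ d → - 1ℤ * a + d) h) (+-identityʳ _))

⊕-⋆≡zeroV⇒≡ : ∀ {n} (u w : Elt n) → u ⊕ ((- 1ℤ) ⋆ w) ≡ zeroV → w ≡ u
⊕-⋆≡zeroV⇒≡ []      []      _ = refl
⊕-⋆≡zeroV⇒≡ (a ∷ u) (b ∷ w) e with ∷-injective e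
... | a-b≡0 , rest = cong₂ _∷_ (scalar a b a-b≡0) (⊕-⋆≡zeroV⇒≡ u w rest)
  where
  undo : ∀ a b → b ≡ a + - 1ℤ * (a + - 1ℤ * b)
  undo = solve-∀
  scalar : ∀ a b → a + - 1ℤ * b ≡ 0ℤ → b ≡ a
  scalar a b h = trans (undo a b) (trans (cong (λ d → a + - 1ℤ * d) h) (+-identityʳ a))

⊕-⋆-swap : ∀ {n} (u w : Elt n) → w ⊕ ((- 1ℤ) ⋆ u) ≡ (- 1ℤ) ⋆ (u ⊕ ((- 1ℤ) ⋆ w))
⊕-⋆-swap []      []      = refl
⊕-⋆-swap (a ∷ u) (b ∷ w) = cong₂ _∷_ (swap a b) (⊕-⋆-swap u w)
  where
  swap : ∀ a b → b + - 1ℤ * a ≡ - 1ℤ * (a + - 1ℤ * b)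
  swap = solve-∀

ΣV-cong : ∀ {m n} {f g : Fin m → Elt n} → (∀ i → f i ≡ g i) → ΣV f ≡ ΣV g
ΣV-cong {zero}  h = refl
ΣV-cong {suc m} h = cong₂ _⊕_ (h zero) (ΣV-cong (h ∘ suc))

ΣV-⊕ : ∀ {m n} (f g : Fin m → Elt n) → ΣV (λ i → f i ⊕ g i) ≡ ΣV f ⊕ ΣV g
ΣV-⊕ {zero}  f g = sym ⊕-zeroV
ΣV-⊕ {suc m} f g = trans (cong ((f zero ⊕ g zero) ⊕_) (ΣV-⊕ (f ∘ suc) (g ∘ suc)))
                         (⊕-interchange (f zero) (g zero) (ΣV (f ∘ suc)) (ΣV (g ∘ suc)))

ΣV-⋆ : ∀ {m n} k (f : Fin m → Elt n) → ΣV (λ i → k ⋆ f i) ≡ k ⋆ ΣV f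
ΣV-⋆ {zero}  k f = sym (⋆-zeroV k)
ΣV-⋆ {suc m} k f = trans (cong ((k ⋆ f zero) ⊕_) (ΣV-⋆ k (f ∘ suc)))
                         (sym (⋆-distribˡ-⊕ k (f zero) (ΣV (f ∘ suc))))

Σℤ-cong : ∀ {m} {f g : Fin m → ℤ} → (∀ i → f i ≡ g i) → Σℤ f ≡ Σℤ g
Σℤ-cong {zero}  h = refl
Σℤ-cong {suc m} h = cong₂ _+_ (h zero) (Σℤ-cong (h ∘ suc))

Σℤ-+ : ∀ {m} (f g : Fin m → ℤ) → Σℤ (λ i → f i + g i) ≡ Σℤ f + Σℤ g
Σℤ-+ {zero}  f g = refl
Σℤ-+ {suc m} f g = trans (cong (_+_ (f zero + g zero)) (Σℤ-+ (f ∘ suc) (g ∘ suc)))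
                         (interchange (f zero) (g zero) (Σℤ (f ∘ suc)) (Σℤ (g ∘ suc)))
  where
  interchange : ∀ a a′ b b′ → (a + a′) + (b + b′) ≡ (a + b) + (a′ + b′)
  interchange = solve-∀

Σℤ-* : ∀ {m} k (f : Fin m → ℤ) → Σℤ (λ i → k * f i) ≡ k * Σℤ f
Σℤ-* {zero}  k f = sym (*-zeroʳ k)
Σℤ-* {suc m} k f = trans (cong (_+_ (k * f zero)) (Σℤ-* k (f ∘ suc)))
                         (sym (*-distribˡ-+ k (f zero) (Σℤ (f ∘ suc))))

module _ {n : ℕ} (f : Fin n → Elt n) where

  linW-⊕ : ∀ x y → linW f (x ⊕ y) ≡ linW f x ⊕ linW f y
  linW-⊕ x y = begin
    ΣV (λ i → lookup (x ⊕ y) i ⋆ f i)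
      ≡⟨ ΣV-cong (λ i → cong (_⋆ f i) (lookup-zipWith _+_ i x y)) ⟩
    ΣV (λ i → (lookup x i + lookup y i) ⋆ f i)
      ≡⟨ ΣV-cong (λ i → ⋆-distribʳ-+ (lookup x i) (lookup y i) (f i)) ⟩
    ΣV (λ i → (lookup x i ⋆ f i) ⊕ (lookup y i ⋆ f i))
      ≡⟨ ΣV-⊕ (λ i → lookup x i ⋆ f i) (λ i → lookup y i ⋆ f i) ⟩
    linW f x ⊕ linW f y ∎

  linW-⋆ : ∀ k x → linW f (k ⋆ x) ≡ k ⋆ linW f x
  linW-⋆ k x = begin
    ΣV (λ i → lookup (k ⋆ x) i ⋆ f i)
      ≡⟨ ΣV-cong (λ i → cong (_⋆ f i) (lookup-map i (k *_) x)) ⟩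
    ΣV (λ i → (k * lookup x i) ⋆ f i)
      ≡⟨ ΣV-cong (λ i → ⋆-assoc k (lookup x i) (f i)) ⟩
    ΣV (λ i → k ⋆ (lookup x i ⋆ f i))
      ≡⟨ ΣV-⋆ k (λ i → lookup x i ⋆ f i) ⟩
    k ⋆ linW f x ∎

module _ {n : ℕ} (str : Fin n → Fin n → Elt n) where

  mulW≡linW : ∀ x z → mulW str x z ≡ linW (λ i → linW (str i) z) x
  mulW≡linW x z = ΣV-cong λ i → begin
    ΣV (λ j → (lookup x i * lookup z j) ⋆ str i j)
      ≡⟨ ΣV-cong (λ j → ⋆-assoc (lookup x i) (lookup z j) (str i j)) ⟩
    ΣV (λ j → lookup x i ⋆ (lookup z j ⋆ str i j))
      ≡⟨ ΣV-⋆ (lookup x i) (λ j → lookup z j ⋆ str i j) ⟩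
    lookup x i ⋆ linW (str i) z ∎

  mulW-⊕ˡ : ∀ x y z → mulW str (x ⊕ y) z ≡ mulW str x z ⊕ mulW str y z
  mulW-⊕ˡ x y z = begin
    mulW str (x ⊕ y) z            ≡⟨ mulW≡linW (x ⊕ y) z ⟩
    linW F (x ⊕ y)                ≡⟨ linW-⊕ F x y ⟩
    linW F x ⊕ linW F y           ≡⟨ sym (cong₂ _⊕_ (mulW≡linW x z) (mulW≡linW y z)) ⟩
    mulW str x z ⊕ mulW str y z   ∎
    where F = λ i → linW (str i) z

  mulW-⋆ˡ : ∀ k x z → mulW str (k ⋆ x) z ≡ k ⋆ mulW str x z
  mulW-⋆ˡ k x z = begin
    mulW str (k ⋆ x) z   ≡⟨ mulW≡linW (k ⋆ x) z ⟩
    linW F (k ⋆ x)       ≡⟨ linW-⋆ F k x ⟩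
    k ⋆ linW F x         ≡⟨ sym (cong (k ⋆_) (mulW≡linW x z)) ⟩
    k ⋆ mulW str x z     ∎
    where F = λ i → linW (str i) z

  trW-⊕ : ∀ x y → trW str (x ⊕ y) ≡ trW str x + trW str y
  trW-⊕ x y = trans (Σℤ-cong diagonal) (Σℤ-+ (diag x) (diag y))
    where
    diag : Elt n → Fin n → ℤ
    diag u j = lookup (mulW str u (basis j)) j
    diagonal : ∀ j → diag (x ⊕ y) j ≡ diag x j + diag y j
    diagonal j = trans (cong (λ u → lookup u j) (mulW-⊕ˡ x y (basis j)))
                       (lookup-zipWith _+_ j (mulW str x (basis j)) (mulW str y (basis j)))

  trW-⋆ : ∀ k x → trW str (k ⋆ x) ≡ k * trW str x
  trW-⋆ k x = trans (Σℤ-cong diagonal) (Σℤ-* k (diag x))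
    where
    diag : Elt n → Fin n → ℤ
    diag u j = lookup (mulW str u (basis j)) j
    diagonal : ∀ j → diag (k ⋆ x) j ≡ k * diag x j
    diagonal j = trans (cong (λ u → lookup u j) (mulW-⋆ˡ k x (basis j)))
                       (lookup-map j (k *_) (mulW str x (basis j)))

module SymmetricBilinear {n : ℕ} (B : Elt n → Elt n → ℤ)
  (B-⊕ˡ : ∀ u u′ w → B (u ⊕ u′) w ≡ B u w + B u′ w)
  (B-⋆ˡ : ∀ k u w → B (k ⋆ u) w ≡ k * B u w)
  (B-sym : ∀ u w → B u w ≡ B w u) where

  B-⊕ʳ : ∀ u w w′ → B u (w ⊕ w′) ≡ B u w + B u w′
  B-⊕ʳ u w w′ = begin
    B u (w ⊕ w′)     ≡⟨ B-sym u (w ⊕ w′) ⟩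
    B (w ⊕ w′) u     ≡⟨ B-⊕ˡ w w′ u ⟩
    B w u + B w′ u   ≡⟨ cong₂ _+_ (B-sym w u) (B-sym w′ u) ⟩
    B u w + B u w′   ∎

  B-⋆ʳ : ∀ k u w → B u (k ⋆ w) ≡ k * B u w
  B-⋆ʳ k u w = begin
    B u (k ⋆ w)   ≡⟨ B-sym u (k ⋆ w) ⟩
    B (k ⋆ w) u   ≡⟨ B-⋆ˡ k w u ⟩
    k * B w u     ≡⟨ cong (k *_) (B-sym w u) ⟩
    k * B u w     ∎

  B-square-⊕ : ∀ u w → B (u ⊕ w) (u ⊕ w) ≡ B u u + (+ 2) * B u w + B w w
  B-square-⊕ u w = begin
    B (u ⊕ w) (u ⊕ w)                      ≡⟨ B-⊕ˡ u w (u ⊕ w) ⟩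
    B u (u ⊕ w) + B w (u ⊕ w)              ≡⟨ cong₂ _+_ (B-⊕ʳ u u w) (B-⊕ʳ w u w) ⟩
    (B u u + B u w) + (B w u + B w w)      ≡⟨ cong (λ b → (B u u + B u w) + (b + B w w)) (B-sym w u) ⟩
    (B u u + B u w) + (B u w + B w w)      ≡⟨ collect (B u u) (B u w) (B w w) ⟩
    B u u + (+ 2) * B u w + B w w          ∎
    where
    collect : ∀ a b c → (a + b) + (b + c) ≡ a + (+ 2) * b + c
    collect = solve-∀

  polarization : ∀ u w → let w⁻ = (- 1ℤ) ⋆ w in
    B (u ⊕ w) (u ⊕ w) + - 1ℤ * B (u ⊕ w⁻) (u ⊕ w⁻) ≡ (+ 4) * B u w
  polarization u w = begin
    B (u ⊕ w) (u ⊕ w) + - 1ℤ * B (u ⊕ w⁻) (u ⊕ w⁻)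
      ≡⟨ cong₂ (λ s d → s + - 1ℤ * d) (B-square-⊕ u w) (B-square-⊕ u w⁻) ⟩
    (B u u + (+ 2) * B u w + B w w) + - 1ℤ * (B u u + (+ 2) * B u w⁻ + B w⁻ w⁻)
      ≡⟨ cong₂ (λ b c → (B u u + (+ 2) * B u w + B w w) + - 1ℤ * (B u u + (+ 2) * b + c))
               (B-⋆ʳ (- 1ℤ) u w)
               (trans (B-⋆ˡ (- 1ℤ) w w⁻) (cong (- 1ℤ *_) (B-⋆ʳ (- 1ℤ) w w))) ⟩
    (B u u + (+ 2) * B u w + B w w)
      + - 1ℤ * (B u u + (+ 2) * (- 1ℤ * B u w) + - 1ℤ * (- 1ℤ * B w w))
      ≡⟨ cancel (B u u) (B u w) (B w w) ⟩
    (+ 4) * B u w ∎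
    where
    w⁻ = (- 1ℤ) ⋆ w
    cancel : ∀ a b c →
      (a + (+ 2) * b + c) + - 1ℤ * (a + (+ 2) * (- 1ℤ * b) + - 1ℤ * (- 1ℤ * c)) ≡ (+ 4) * b
    cancel = solve-∀

module _ {n : ℕ} (O : CMOrder n) where
  open CMOrder O

  private
    infixl 7 _∙_
    _∙_ : Elt n → Elt n → Elt n
    _∙_ = _·_ O

  ∙-⊕ʳ : ∀ x y z → x ∙ (y ⊕ z) ≡ (x ∙ y) ⊕ (x ∙ z)
  ∙-⊕ʳ x y z = begin
    x ∙ (y ⊕ z)           ≡⟨ mul-comm x (y ⊕ z) ⟩
    (y ⊕ z) ∙ x           ≡⟨ mulW-⊕ˡ str y z x ⟩
    (y ∙ x) ⊕ (z ∙ x)     ≡⟨ cong₂ _⊕_ (mul-comm y x) (mul-comm z x) ⟩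
    (x ∙ y) ⊕ (x ∙ z)     ∎

  ∙-⋆ʳ : ∀ k x z → x ∙ (k ⋆ z) ≡ k ⋆ (x ∙ z)
  ∙-⋆ʳ k x z = begin
    x ∙ (k ⋆ z)     ≡⟨ mul-comm x (k ⋆ z) ⟩
    (k ⋆ z) ∙ x     ≡⟨ mulW-⋆ˡ str k z x ⟩
    k ⋆ (z ∙ x)     ≡⟨ cong (k ⋆_) (mul-comm z x) ⟩
    k ⋆ (x ∙ z)     ∎

  ∙-interchange : ∀ a b c d → (a ∙ b) ∙ (c ∙ d) ≡ (a ∙ c) ∙ (b ∙ d)
  ∙-interchange a b c d = begin
    (a ∙ b) ∙ (c ∙ d)   ≡⟨ mul-assoc a b (c ∙ d) ⟩
    a ∙ (b ∙ (c ∙ d))   ≡⟨ cong (a ∙_) (sym (mul-assoc b c d)) ⟩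
    a ∙ ((b ∙ c) ∙ d)   ≡⟨ cong (λ e → a ∙ (e ∙ d)) (mul-comm b c) ⟩
    a ∙ ((c ∙ b) ∙ d)   ≡⟨ cong (a ∙_) (mul-assoc c b d) ⟩
    a ∙ (c ∙ (b ∙ d))   ≡⟨ sym (mul-assoc a c (b ∙ d)) ⟩
    (a ∙ c) ∙ (b ∙ d)   ∎

  traceForm : Elt n → Elt n → Elt n → ℤ
  traceForm v u w = tr O ((v ∙ conj O v) ∙ (u ∙ w))

  traceForm-⊕ˡ : ∀ v u u′ w → traceForm v (u ⊕ u′) w ≡ traceForm v u w + traceForm v u′ w
  traceForm-⊕ˡ v u u′ w = begin
    tr O (P ∙ ((u ⊕ u′) ∙ w))               ≡⟨ cong (λ e → tr O (P ∙ e)) (mulW-⊕ˡ str u u′ w) ⟩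
    tr O (P ∙ ((u ∙ w) ⊕ (u′ ∙ w)))         ≡⟨ cong (tr O) (∙-⊕ʳ P (u ∙ w) (u′ ∙ w)) ⟩
    tr O ((P ∙ (u ∙ w)) ⊕ (P ∙ (u′ ∙ w)))   ≡⟨ trW-⊕ str (P ∙ (u ∙ w)) (P ∙ (u′ ∙ w)) ⟩
    traceForm v u w + traceForm v u′ w                ∎
    where P = v ∙ conj O v

  traceForm-⋆ˡ : ∀ v k u w → traceForm v (k ⋆ u) w ≡ k * traceForm v u w
  traceForm-⋆ˡ v k u w = begin
    tr O (P ∙ ((k ⋆ u) ∙ w))   ≡⟨ cong (λ e → tr O (P ∙ e)) (mulW-⋆ˡ str k u w) ⟩
    tr O (P ∙ (k ⋆ (u ∙ w)))   ≡⟨ cong (tr O) (∙-⋆ʳ k P (u ∙ w)) ⟩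
    tr O (k ⋆ (P ∙ (u ∙ w)))   ≡⟨ trW-⋆ str k (P ∙ (u ∙ w)) ⟩
    k * traceForm v u w             ∎
    where P = v ∙ conj O v

  traceForm-sym : ∀ v u w → traceForm v u w ≡ traceForm v w u
  traceForm-sym v u w = cong (λ e → tr O ((v ∙ conj O v) ∙ e)) (mul-comm u w)

  q-∙ : ∀ v a → q O (v ∙ a) ≡ traceForm v a (conj O a)
  q-∙ v a = cong (tr O) (begin
    (v ∙ a) ∙ conj O (v ∙ a)              ≡⟨ cong ((v ∙ a) ∙_) (conj-mul v a) ⟩
    (v ∙ a) ∙ (conj O v ∙ conj O a)       ≡⟨ ∙-interchange v a (conj O v) (conj O a) ⟩
    (v ∙ conj O v) ∙ (a ∙ conj O a)       ∎)

  plusPart minusPart : Elt n → Elt n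
  plusPart  a = a ⊕ conj O a
  minusPart a = a ⊕ ((- 1ℤ) ⋆ conj O a)

  conj-plusPart : ∀ a → conj O (plusPart a) ≡ plusPart a
  conj-plusPart a = begin
    conj O (a ⊕ conj O a)              ≡⟨ linW-⊕ conjB a (conj O a) ⟩
    conj O a ⊕ conj O (conj O a)       ≡⟨ cong (conj O a ⊕_) (conj-invol a) ⟩
    conj O a ⊕ a                       ≡⟨ ⊕-comm (conj O a) a ⟩
    a ⊕ conj O a                       ∎

  conj-minusPart : ∀ a → conj O (minusPart a) ≡ (- 1ℤ) ⋆ minusPart a
  conj-minusPart a = begin
    conj O (a ⊕ ((- 1ℤ) ⋆ conj O a))             ≡⟨ linW-⊕ conjB a ((- 1ℤ) ⋆ conj O a) ⟩
    conj O a ⊕ conj O ((- 1ℤ) ⋆ conj O a)        ≡⟨ cong (conj O a ⊕_) (linW-⋆ conjB (- 1ℤ) (conj O a)) ⟩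
    conj O a ⊕ ((- 1ℤ) ⋆ conj O (conj O a))      ≡⟨ cong (λ e → conj O a ⊕ ((- 1ℤ) ⋆ e)) (conj-invol a) ⟩
    conj O a ⊕ ((- 1ℤ) ⋆ a)                      ≡⟨ ⊕-⋆-swap a (conj O a) ⟩
    (- 1ℤ) ⋆ minusPart a                         ∎

  parallelogram : ∀ v a →
    q O (v ∙ plusPart a) + q O (v ∙ minusPart a) ≡ (+ 4) * q O (v ∙ a)
  parallelogram v a = begin
    q O (v ∙ b) + q O (v ∙ c)
      ≡⟨ cong₂ _+_ (q-∙ v b) (q-∙ v c) ⟩
    traceForm v b (conj O b) + traceForm v c (conj O c)
      ≡⟨ cong₂ (λ b̄ c̄ → traceForm v b b̄ + traceForm v c c̄) (conj-plusPart a) (conj-minusPart a) ⟩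
    traceForm v b b + traceForm v c ((- 1ℤ) ⋆ c)
      ≡⟨ cong (_+_ (traceForm v b b)) (B-⋆ʳ (- 1ℤ) c c) ⟩
    traceForm v b b + - 1ℤ * traceForm v c c
      ≡⟨ polarization a (conj O a) ⟩
    (+ 4) * traceForm v a (conj O a)
      ≡⟨ cong ((+ 4) *_) (sym (q-∙ v a)) ⟩
    (+ 4) * q O (v ∙ a) ∎
    where
    b = plusPart a
    c = minusPart a
    open SymmetricBilinear (traceForm v) (traceForm-⊕ˡ v) (traceForm-⋆ˡ v) (traceForm-sym v)

  shortSymmetricVector : ∀ v a → NonZeroDivisor O v → v ∙ a ≢ zeroV →
    Σ (Elt n) (λ y → y ≢ zeroV × (InPlus O v y ⊎ InMinus O v y) ×
      (0ℤ < q O y) × (q O y ≤ (+ 2) * q O (v ∙ a)))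
  shortSymmetricVector v a v-regular va≢0
    with ≡-dec _≟_ (plusPart a) zeroV | ≡-dec _≟_ (minusPart a) zeroV
  ... | yes a⁺≡0 | _ =
    v ∙ a , va≢0 , inj₂ (a , ⊕≡zeroV⇒≡-⋆ a (conj O a) a⁺≡0 , refl) ,
    posdef (v ∙ a) va≢0 , i≤2*i (<⇒≤ (posdef (v ∙ a) va≢0))
  ... | no _ | yes a⁻≡0 =
    v ∙ a , va≢0 , inj₁ (a , ⊕-⋆≡zeroV⇒≡ a (conj O a) a⁻≡0 , refl) ,
    posdef (v ∙ a) va≢0 , i≤2*i (<⇒≤ (posdef (v ∙ a) va≢0))
  ... | no a⁺≢0 | no a⁻≢0 with +≡4*⇒≤2*⊎≤2* (parallelogram v a)
  ...   | inj₁ ≤2q =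
    v ∙ plusPart a , va⁺≢0 , inj₁ (plusPart a , conj-plusPart a , refl) , posdef _ va⁺≢0 , ≤2q
    where
    va⁺≢0 : v ∙ plusPart a ≢ zeroV
    va⁺≢0 = a⁺≢0 ∘ v-regular (plusPart a)
  ...   | inj₂ ≤2q =
    v ∙ minusPart a , va⁻≢0 , inj₂ (minusPart a , conj-minusPart a , refl) , posdef _ va⁻≢0 , ≤2q
    where
    va⁻≢0 : v ∙ minusPart a ≢ zeroV
    va⁻≢0 = a⁻≢0 ∘ v-regular (minusPart a)

mainTheorem14 : {n : ℕ} (O : CMOrder n) (v : Elt n) →
    NonZeroDivisor O v →
    (x : Elt n) → InPrincipal O v x → x ≢ zeroV →
    ((z : Elt n) → InPrincipal O v z → z ≢ zeroV → q O x ≤ q O z) →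
    (Σ (Elt n) (λ y → y ≢ zeroV × (InPlus O v y ⊎ InMinus O v y) ×
        (0ℤ < q O y) × (q O y ≤ (+ 2) * q O x)))
    × ((y : Elt n) → InPlus O v y → InPrincipal O v y)
    × ((y : Elt n) → InMinus O v y → InPrincipal O v y)
mainTheorem14 O v v-regular x (a , refl) x≢0 _ =
  shortSymmetricVector O v a v-regular x≢0 ,
  (λ { _ (b , _ , y≡vb) → b , y≡vb }) ,
  (λ { _ (b , _ , y≡vb) → b , y≡vb })
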